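{- Let $P=(X,\leq_P)$ and $Q$ be connected finite posets with at least two points, and let $f:P\to Q$ be an order homomorphism with $E(Q)\subseteq f[X]$. Then $L(Q)\subseteq f[L(P)]$ and $U(Q)\subseteq f[U(P)]$.
   Context: $L(P)$, $U(P)$: the sets of minimal and maximal points of $P$; $E(Q)=L(Q)\cup U(Q)$. -}

module Defs where

open import Level using (0ℓ)
open import Data.Nat using (ℕ; _≤_)
open import Data.Fin using (Fin)
open import Data.Product using (Σ; _×_; ∃)
open import Data.Sum using (_⊎_)
open import Relation.Binary using (Rel; IsDecPartialOrder)
open import Relation.Binary.PropositionalEquality using (_≡_)
open import Relation.Binary.Construct.Closure.ReflexiveTransitive using (Star)

record FinPoset : Set₁ where
  field
    size              : ℕ
    _≤ₚ_              : Rel (Fin size) 0ℓ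
    isDecPartialOrder : IsDecPartialOrder _≡_ _≤ₚ_

open FinPoset public

Point : FinPoset → Set
Point P = Fin (size P)

Comparable : (P : FinPoset) → Rel (Point P) 0ℓ
Comparable P x y = _≤ₚ_ P x y ⊎ _≤ₚ_ P y x

Connected : FinPoset → Set
Connected P = ∀ (x y : Point P) → Star (Comparable P) x y

AtLeastTwo : FinPoset → Set
AtLeastTwo P = 2 ≤ size P

Minimal : (P : FinPoset) → Point P → Set
Minimal P x = ∀ (y : Point P) → _≤ₚ_ P y x → y ≡ x

Maximal : (P : FinPoset) → Point P → Set
Maximal P x = ∀ (y : Point P) → _≤ₚ_ P x y → y ≡ x

Extremal : (P : FinPoset) → Point P → Set
Extremal P x = Minimal P x ⊎ Maximal P x

OrderHom : (P Q : FinPoset) → (Point P → Point Q) → Set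
OrderHom P Q f = ∀ (x y : Point P) → _≤ₚ_ P x y → _≤ₚ_ Q (f x) (f y)

InImageOf : {P Q : FinPoset} → (Point P → Point Q) → (Point P → Set) → Point Q → Set
InImageOf {P} f S q = Σ (Point P) (λ x → S x × f x ≡ q)

InImage : {P Q : FinPoset} → (Point P → Point Q) → Point Q → Set
InImage {P} f q = Σ (Point P) (λ x → f x ≡ q)

{-# OPTIONS --safe #-}

-- Every point of a finite poset lies above a minimal point, since the strict
-- order is well founded (its down-sets shrink strictly). So if a minimal q of
-- Q is f x, pick a minimal m ≤ x in P: then f m ≤ f x = q, hence f m = q by
-- minimality of q. Maximal points are the minimal points of the dual posets.
module Submission where

open import Level using (0ℓ)
open import Data.Bool.Properties using (T-≡)
open import Data.Empty using (⊥-elim)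
open import Data.Fin.Properties using (any?)
open import Data.Fin.Subset using (Subset; _∈_; _⊂_)
open import Data.Fin.Subset.Induction using (⊂-wellFounded)
open import Data.Product using (_×_; _,_; proj₁; ∃-syntax)
open import Data.Sum using (inj₁; inj₂)
open import Data.Vec using (tabulate)
open import Data.Vec.Properties using (lookup∘tabulate; []=⇒lookup; lookup⇒[]=)
open import Function using (flip)
open import Function.Bundles using (Equivalence)
open import Induction.WellFounded using (WellFounded; Acc; acc; module Subrelation)
open import Relation.Binary using (Rel; IsDecPartialOrder)
import Relation.Binary.Construct.Flip.EqAndOrd as Flip
import Relation.Binary.Construct.On as On
open import Relation.Binary.PropositionalEquality using (_≢_; trans; sym; subst)
open import Relation.Nullary using (yes; no)
open import Relation.Nullary.Decidable using (⌊_⌋; toWitness; fromWitness; ¬?; _×-dec_)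

open import Defs

dual : FinPoset → FinPoset
dual P = record
  { size              = size P
  ; _≤ₚ_              = flip (_≤ₚ_ P)
  ; isDecPartialOrder = record
    { isPartialOrder = Flip.isPartialOrder isPartialOrder
    ; _≟_            = _≟_
    ; _≤?_           = flip _≤?_
    }
  }
  where open IsDecPartialOrder (isDecPartialOrder P)

module _ (P : FinPoset) where
  open IsDecPartialOrder (isDecPartialOrder P)
    renaming (refl to ≤-refl; trans to ≤-trans; antisym to ≤-antisym)

  private
    _≤_ : Rel (Point P) 0ℓ
    _≤_ = _≤ₚ_ P

  _<ₚ_ : Rel (Point P) 0ℓ
  x <ₚ y = x ≤ y × x ≢ y

  downset : Point P → Subset (size P)
  downset x = tabulate (λ z → ⌊ z ≤? x ⌋)

  ∈-downset⁺ : ∀ {z x} → z ≤ x → z ∈ downset x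
  ∈-downset⁺ {z} {x} z≤x = lookup⇒[]= z (downset x)
    (trans (lookup∘tabulate _ z) (Equivalence.to T-≡ (fromWitness z≤x)))

  ∈-downset⁻ : ∀ {z x} → z ∈ downset x → z ≤ x
  ∈-downset⁻ {z} {x} z∈x = toWitness (Equivalence.from T-≡
    (trans (sym (lookup∘tabulate _ z)) ([]=⇒lookup z∈x)))

  <⇒downset⊂ : ∀ {y x} → y <ₚ x → downset y ⊂ downset x
  <⇒downset⊂ (y≤x , y≢x) =
      (λ z∈y → ∈-downset⁺ (≤-trans (∈-downset⁻ z∈y) y≤x))
    , _ , ∈-downset⁺ ≤-refl , λ x∈y → y≢x (≤-antisym y≤x (∈-downset⁻ x∈y))

  <ₚ-wellFounded : WellFounded _<ₚ_
  <ₚ-wellFounded = Subrelation.wellFounded <⇒downset⊂ (On.wellFounded downset ⊂-wellFounded)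

  minimal-below : ∀ x → ∃[ m ] Minimal P m × m ≤ x
  minimal-below x = go x (<ₚ-wellFounded x)
    where
    go : ∀ x → Acc _<ₚ_ x → ∃[ m ] Minimal P m × m ≤ x
    go x (acc rs) with any? (λ y → y ≤? x ×-dec ¬? (y ≟ x))
    ... | yes (y , y<x) with go y (rs y<x)
    ...   | m , m-min , m≤y = m , m-min , ≤-trans m≤y (proj₁ y<x)
    go x (acc rs) | no ∄y<x = x , x-min , ≤-refl
      where
      x-min : Minimal P x
      x-min y y≤x with y ≟ x
      ... | yes y≡x = y≡x
      ... | no  y≢x = ⊥-elim (∄y<x (y , y≤x , y≢x))

minimal-preimage : (P Q : FinPoset) (f : Point P → Point Q) → OrderHom P Q f →
  ∀ q → Minimal Q q → InImage {P} {Q} f q → InImageOf {P} {Q} f (Minimal P) q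
minimal-preimage P Q f f-mono q q-min (x , fx≡q) with minimal-below P x
... | m , m-min , m≤x = m , m-min , q-min (f m) (subst (_≤ₚ_ Q (f m)) fx≡q (f-mono m x m≤x))

corollary1 : (P Q : FinPoset) → Connected P → Connected Q → AtLeastTwo P → AtLeastTwo Q →
    (f : Point P → Point Q) → OrderHom P Q f →
    (∀ (q : Point Q) → Extremal Q q → InImage {P} {Q} f q) →
    (∀ (q : Point Q) → Minimal Q q → InImageOf {P} {Q} f (Minimal P) q)
    × (∀ (q : Point Q) → Maximal Q q → InImageOf {P} {Q} f (Maximal P) q)
corollary1 P Q _ _ _ _ f f-mono extremal-in-image =
    (λ q q-min → minimal-preimage P Q f f-mono q q-min (extremal-in-image q (inj₁ q-min)))
  , (λ q q-max → minimal-preimage (dual P) (dual Q) f (flip f-mono) q q-max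
                   (extremal-in-image q (inj₂ q-max)))
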